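{- For every nonempty initial segment $\mathcal{D}$ of the binary order on $\mathcal{B}(n)$, $$\frac{w(\mathcal{D})}{|\mathcal{D}|} \ \ge\ \frac{w(\mathcal{B}(n))}{|\mathcal{B}(n)|} = \frac{\binom{n}{\lfloor n/2\rfloor}}{2^n}.$$
   Context: $\mathcal{B}(n)$ is the family of all subsets of $[n]=\{1,\dots,n\}$ ordered by inclusion. The binary order $<_b$: $A <_b B$ if $\max(A\triangle B) \in B$; its initial segments are downsets, called binary downsets. The width $w(\mathcal{X})$ is the maximum size of an antichain (with respect to inclusion) in $\mathcal{X}$. -}

module Defs where

open import Data.Bool using (Bool; true; false)
open import Data.Nat using (ℕ; zero; suc; _<_; _*_; _^_; _≤_; ⌊_/2⌋)
open import Data.Fin using (Fin; toℕ)
open import Data.Fin.Subset using (Subset; _∈_; _∉_; _⊆_; outside; inside)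
open import Data.List using (List; []; _∷_; _++_; map; length; filter)
open import Data.List.Relation.Unary.All using (All)
open import Data.List.Relation.Unary.AllPairs using (AllPairs)
open import Data.Vec using (_∷_; [])
open import Data.Product using (Σ; _×_; ∃)
open import Relation.Binary.PropositionalEquality using (_≡_)
open import Relation.Nullary using (¬_)
open import Function.Bundles using (_⇔_)

Family : ℕ → Set
Family n = Subset n → Bool

-- Binary order: A <_b B iff max(A △ B) ∈ B, i.e. there is an index i
-- with i ∈ B, i ∉ A, and A, B agree on all indices above i.
_<b_ : ∀ {n} → Subset n → Subset n → Set
_<b_ {n} A B = Σ (Fin n) λ i → (i ∈ B) × (i ∉ A) ×
  (∀ (j : Fin n) → toℕ i < toℕ j → (j ∈ A ⇔ j ∈ B))

IsBinaryInitialSegment : ∀ {n} → Family n → Set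
IsBinaryInitialSegment {n} D =
  ∀ (A B : Subset n) → A <b B → D B ≡ true → D A ≡ true

Nonempty : ∀ {n} → Family n → Set
Nonempty {n} D = Σ (Subset n) λ A → D A ≡ true

allSubsets : (n : ℕ) → List (Subset n)
allSubsets zero = [] ∷ []
allSubsets (suc n) = map (outside ∷_) (allSubsets n) ++ map (inside ∷_) (allSubsets n)

card : ∀ {n} → Family n → ℕ
card {n} D = length (filter (λ A → D A Data.Bool.≟ true) (allSubsets n))
  where import Data.Bool

full : ∀ {n} → Family n
full _ = true

-- Antichain (w.r.t. inclusion) in D, given as a list of members of D
-- that are pairwise incomparable (hence pairwise distinct).
IsAntichainIn : ∀ {n} → Family n → List (Subset n) → Set
IsAntichainIn D L =
  All (λ A → D A ≡ true) L × AllPairs (λ A B → ¬ (A ⊆ B) × ¬ (B ⊆ A)) L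

IsWidth : ∀ {n} → Family n → ℕ → Set
IsWidth {n} D w =
  (Σ (List (Subset n)) λ L → IsAntichainIn D L × length L ≡ w) ×
  (∀ (L : List (Subset n)) → IsAntichainIn D L → length L ≤ w)

-- Width of B(n): de Bruijn's doubling construction decomposes B(n) into n C ⌊n/2⌋
-- symmetric chains (counted through the number of chains of each length), an antichain
-- meets every chain at most once, and the middle level is an antichain of that size.
--
-- Density: the element n decides the binary order first, so a binary downset D of B(n) has
-- binary downsets D₀ = {X ∈ D : n ∉ X} and D₁ = {X : X ∪ {n} ∈ D} of B(n−1) as slices, and
-- D₀ = B(n−1) as soon as D₁ ≠ ∅. By induction on n, for every r with 2r ≤ n, D contains an
-- antichain A of sets of size at most r with (n C r)·|D| ≤ |A|·2ⁿ. If D₁ = ∅ the antichain of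
-- D₀ serves, since n C r ≤ 2·((n−1) C r′) for r′ = r or r′ = r − 1 with 2r′ ≤ n − 1.
-- Otherwise level r of B(n−1) lies in D₀, and together with {Y ∪ {n} : Y ∈ A₁}, for the
-- antichain A₁ of D₁ with sets of size at most r − 1, it forms an antichain; the bound follows
-- from (n−1) C (r−1) ≤ (n−1) C r. The theorem is the case r = ⌊n/2⌋.

module Submission where

open import Defs
open import Data.Bool using (Bool; true; false; _≟_)
open import Data.Empty using (⊥-elim)
open import Data.Fin as Fin using (Fin; zero; suc; toℕ; fromℕ; inject₁)
import Data.Fin.Properties as Fin
open import Data.Fin.Subset using (Subset; _∈_; _⊆_; ∣_∣; outside; inside) renaming (⊥ to ∅)
open import Data.Fin.Subset.Properties using (drop-∷-⊆; p⊆q⇒∣p∣≤∣q∣; ∣⊥∣≡0; out⊆; s⊆s; ⊆-refl)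
open import Data.List using (List; []; _∷_; _++_; map; concatMap; length; filter; lookup)
import Data.List.Properties as List
open import Data.List.Membership.Propositional using () renaming (_∈_ to _∈ₗ_)
open import Data.List.Membership.Propositional.Properties using (∈-filter⁻; ∈-lookup)
open import Data.List.Relation.Unary.All as All using (All; []; _∷_)
import Data.List.Relation.Unary.All.Properties as All
open import Data.List.Relation.Unary.AllPairs as AllPairs using (AllPairs; []; _∷_)
import Data.List.Relation.Unary.AllPairs.Properties as AllPairs
open import Data.List.Relation.Unary.Any as Any using (Any; here; there)
import Data.List.Relation.Unary.Any.Properties as Any
open import Data.Nat using (ℕ; zero; suc; _+_; _*_; _^_; _≤_; _<_; z≤n; s≤s; _≤?_; s≤s⁻¹; ⌊_/2⌋)
open import Data.Nat.Properties hiding (_≟_)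
open import Data.Nat.Combinatorics using (_C_; nCk+nC[k+1]≡[n+1]C[k+1]; nC1≡n; nCk≡nC[n∸k])
open import Data.Nat.Tactic.RingSolver using (solve-∀)
open import Algebra.Properties.CommutativeSemigroup +-commutativeSemigroup using () renaming (interchange to +-interchange)
open import Data.Product using (_×_; _,_; proj₁; proj₂; ∃)
open import Data.Sum as Sum using (_⊎_; inj₁; inj₂; [_,_]′)
open import Data.Vec as Vec using (_∷ʳ_; []; _∷_)
open import Function using (_∘_; id; case_of_)
open import Function.Bundles using (_⇔_; mk⇔; Equivalence)
import Function.Properties.Equivalence as ⇔
open import Relation.Binary using (Rel; Reflexive)
open import Relation.Nullary using (¬_; does; yes; no)
open import Relation.Unary using (Decidable)
open import Relation.Binary.PropositionalEquality using (_≡_; refl; sym; trans; cong; cong₂; subst; subst₂)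

module _ {a ℓ} {A : Set a} {R : Rel A ℓ} where

  AllPairs-lookup : ∀ {xs} → AllPairs R xs → ∀ {i j} → i Fin.< j → R (lookup xs i) (lookup xs j)
  AllPairs-lookup (Rx ∷ _) {zero} {suc j} _ = All.lookup Rx (∈-lookup j)
  AllPairs-lookup (_ ∷ Rxs) {suc i} {suc j} (s≤s i<j) = AllPairs-lookup Rxs i<j

module _ {a ℓ} {A : Set a} {_≼_ : Rel A ℓ} (≼-refl : Reflexive _≼_) where

  comparable-in-chain : ∀ {c x y} → AllPairs _≼_ c → x ∈ₗ c → y ∈ₗ c → x ≼ y ⊎ y ≼ x
  comparable-in-chain (_ ∷ _) (here refl) (here refl) = inj₁ ≼-refl
  comparable-in-chain (x≼ ∷ _) (here refl) (there y∈c) = inj₁ (All.lookup x≼ y∈c)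
  comparable-in-chain (x≼ ∷ _) (there x∈c) (here refl) = inj₂ (All.lookup x≼ x∈c)
  comparable-in-chain (_ ∷ c) (there x∈c) (there y∈c) = comparable-in-chain c x∈c y∈c

  antichain-length≤#chains : ∀ {cs xs} → All (AllPairs _≼_) cs → (∀ x → Any (x ∈ₗ_) cs) →
    AllPairs (λ x y → ¬ x ≼ y × ¬ y ≼ x) xs → length xs ≤ length cs
  antichain-length≤#chains {cs} {xs} chains cover antichain = ≮⇒≥ λ cs<xs →
    let i , j , i<j , same = Fin.pigeonhole cs<xs chainOf
        xᵢ∈c = Any.lookup-index (cover (lookup xs i))
        xⱼ∈c = subst (λ k → lookup xs j ∈ₗ lookup cs k) (sym same) (Any.lookup-index (cover (lookup xs j)))
        xᵢ⋠xⱼ , xⱼ⋠xᵢ = AllPairs-lookup antichain i<j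
    in [ xᵢ⋠xⱼ , xⱼ⋠xᵢ ]′ (comparable-in-chain (All.lookup chains (∈-lookup (chainOf i))) xᵢ∈c xⱼ∈c)
    where
    chainOf : Fin (length xs) → Fin (length cs)
    chainOf i = Any.index (cover (lookup xs i))

-- Adding a largest element

inject₁∈∷ʳ⇔∈ : ∀ {n} {p : Subset n} {a i} → inject₁ i ∈ p ∷ʳ a ⇔ i ∈ p
inject₁∈∷ʳ⇔∈ = mk⇔ to from
  where
  to : ∀ {n} {p : Subset n} {a i} → inject₁ i ∈ p ∷ʳ a → i ∈ p
  to {p = _ ∷ _} {i = zero} Vec.here = Vec.here
  to {p = _ ∷ _} {i = suc i} (Vec.there i∈) = Vec.there (to i∈)
  from : ∀ {n} {p : Subset n} {a i} → i ∈ p → inject₁ i ∈ p ∷ʳ a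
  from Vec.here = Vec.here
  from (Vec.there i∈) = Vec.there (from i∈)

fromℕ∈∷ʳ⇔ : ∀ {n} {p : Subset n} {a} → fromℕ n ∈ p ∷ʳ a ⇔ a ≡ inside
fromℕ∈∷ʳ⇔ = mk⇔ to from
  where
  to : ∀ {n} {p : Subset n} {a} → fromℕ n ∈ p ∷ʳ a → a ≡ inside
  to {p = []} Vec.here = refl
  to {p = _ ∷ _} (Vec.there i∈) = to i∈
  from : ∀ {n} {p : Subset n} {a} → a ≡ inside → fromℕ n ∈ p ∷ʳ a
  from {p = []} refl = Vec.here
  from {p = _ ∷ _} a≡inside = Vec.there (from a≡inside)

∷ʳ-⊆⁻ : ∀ {n} {p q : Subset n} {a b} → p ∷ʳ a ⊆ q ∷ʳ b → p ⊆ q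
∷ʳ-⊆⁻ pa⊆qb = Equivalence.to inject₁∈∷ʳ⇔∈ ∘ pa⊆qb ∘ Equivalence.from inject₁∈∷ʳ⇔∈

∷ʳinside⊈∷ʳoutside : ∀ {n} {p q : Subset n} → ¬ p ∷ʳ inside ⊆ q ∷ʳ outside
∷ʳinside⊈∷ʳoutside pi⊆qo with () ← Equivalence.to fromℕ∈∷ʳ⇔ (pi⊆qo (Equivalence.from fromℕ∈∷ʳ⇔ refl))

∣p∷ʳoutside∣≡∣p∣ : ∀ {n} (p : Subset n) → ∣ p ∷ʳ outside ∣ ≡ ∣ p ∣
∣p∷ʳoutside∣≡∣p∣ [] = refl
∣p∷ʳoutside∣≡∣p∣ (outside ∷ p) = ∣p∷ʳoutside∣≡∣p∣ p
∣p∷ʳoutside∣≡∣p∣ (inside ∷ p) = cong suc (∣p∷ʳoutside∣≡∣p∣ p)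

∣p∷ʳinside∣≡1+∣p∣ : ∀ {n} (p : Subset n) → ∣ p ∷ʳ inside ∣ ≡ suc ∣ p ∣
∣p∷ʳinside∣≡1+∣p∣ [] = refl
∣p∷ʳinside∣≡1+∣p∣ (outside ∷ p) = ∣p∷ʳinside∣≡1+∣p∣ p
∣p∷ʳinside∣≡1+∣p∣ (inside ∷ p) = cong suc (∣p∷ʳinside∣≡1+∣p∣ p)

infix 4 _∥_

_∥_ : ∀ {n} → Subset n → Subset n → Set
p ∥ q = ¬ p ⊆ q × ¬ q ⊆ p

∷-∥ : ∀ {n} {p q : Subset n} a → p ∥ q → (a ∷ p) ∥ (a ∷ q)
∷-∥ _ (p⊈q , q⊈p) = p⊈q ∘ drop-∷-⊆ , q⊈p ∘ drop-∷-⊆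

∷ʳ-∥ : ∀ {n} {p q : Subset n} a → p ∥ q → (p ∷ʳ a) ∥ (q ∷ʳ a)
∷ʳ-∥ _ (p⊈q , q⊈p) = p⊈q ∘ ∷ʳ-⊆⁻ , q⊈p ∘ ∷ʳ-⊆⁻

map-∷-antichain : ∀ {n} {ps : List (Subset n)} a → AllPairs _∥_ ps → AllPairs _∥_ (map (a ∷_) ps)
map-∷-antichain a = AllPairs.map⁺ ∘ AllPairs.map (∷-∥ a)

map-∷ʳ-antichain : ∀ {n} {ps : List (Subset n)} a → AllPairs _∥_ ps → AllPairs _∥_ (map (_∷ʳ a) ps)
map-∷ʳ-antichain a = AllPairs.map⁺ ∘ AllPairs.map (∷ʳ-∥ a)

outside∷-∥-inside∷ : ∀ {n} {p q : Subset n} → ∣ q ∣ < ∣ p ∣ → (outside ∷ p) ∥ (inside ∷ q)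
outside∷-∥-inside∷ ∣q∣<∣p∣ =
  <⇒≱ ∣q∣<∣p∣ ∘ p⊆q⇒∣p∣≤∣q∣ ∘ drop-∷-⊆ , λ iq⊆op → case iq⊆op Vec.here of λ ()

∷ʳoutside-∥-∷ʳinside : ∀ {n} {p q : Subset n} → ∣ q ∣ < ∣ p ∣ → (p ∷ʳ outside) ∥ (q ∷ʳ inside)
∷ʳoutside-∥-∷ʳinside ∣q∣<∣p∣ =
  <⇒≱ ∣q∣<∣p∣ ∘ p⊆q⇒∣p∣≤∣q∣ ∘ ∷ʳ-⊆⁻ , ∷ʳinside⊈∷ʳoutside

-- Binary downsets

fromℕ⊎inject₁ : ∀ {n} (j : Fin (suc n)) → j ≡ fromℕ n ⊎ ∃ λ i → j ≡ inject₁ i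
fromℕ⊎inject₁ {zero} zero = inj₁ refl
fromℕ⊎inject₁ {suc n} zero = inj₂ (zero , refl)
fromℕ⊎inject₁ {suc n} (suc j) with fromℕ⊎inject₁ j
... | inj₁ refl = inj₁ refl
... | inj₂ (i , refl) = inj₂ (suc i , refl)

∷ʳ-<b : ∀ {n} {p q : Subset n} a → p <b q → (p ∷ʳ a) <b (q ∷ʳ a)
∷ʳ-<b {n} {p} {q} a (i , i∈q , i∉p , agree) =
  inject₁ i , from inject₁∈∷ʳ⇔∈ i∈q , i∉p ∘ to inject₁∈∷ʳ⇔∈ , agree′
  where
  open Equivalence
  agree′ : ∀ j → toℕ (inject₁ i) < toℕ j → (j ∈ p ∷ʳ a ⇔ j ∈ q ∷ʳ a)
  agree′ j i<j with fromℕ⊎inject₁ j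
  ... | inj₁ refl = ⇔.trans fromℕ∈∷ʳ⇔ (⇔.sym fromℕ∈∷ʳ⇔)
  ... | inj₂ (k , refl) = ⇔.trans inject₁∈∷ʳ⇔∈
    (⇔.trans (agree k (subst₂ _<_ (Fin.toℕ-inject₁ i) (Fin.toℕ-inject₁ k) i<j)) (⇔.sym inject₁∈∷ʳ⇔∈))

∷ʳoutside<b∷ʳinside : ∀ {n} (p q : Subset n) → (p ∷ʳ outside) <b (q ∷ʳ inside)
∷ʳoutside<b∷ʳinside {n} p q =
  fromℕ n , from fromℕ∈∷ʳ⇔ refl , (λ ()) ∘ to fromℕ∈∷ʳ⇔ , λ j n<j → ⊥-elim (<⇒≱ n<j (top j))
  where
  open Equivalence
  top : ∀ j → toℕ j ≤ toℕ (fromℕ n)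
  top j = subst (toℕ j ≤_) (sym (Fin.toℕ-fromℕ n)) (Fin.toℕ≤pred[n] j)

slice : ∀ {n} → Family (suc n) → Bool → Family n
slice D a X = D (X ∷ʳ a)

module _ {n} {D : Family (suc n)} (downset : IsBinaryInitialSegment D) where

  slice-downset : ∀ a → IsBinaryInitialSegment (slice D a)
  slice-downset a p q p<q = downset _ _ (∷ʳ-<b a p<q)

  slice-outside-full : ∀ {q} → slice D inside q ≡ true → ∀ p → slice D outside p ≡ true
  slice-outside-full Dq p = downset _ _ (∷ʳoutside<b∷ʳinside p _) Dq

∅∷ʳoutside : ∀ n → ∅ {suc n} ≡ ∅ ∷ʳ outside
∅∷ʳoutside zero = refl
∅∷ʳoutside (suc n) = cong (outside ∷_) (∅∷ʳoutside n)

∅-∈-downset : ∀ {n} {D : Family n} → IsBinaryInitialSegment D → ∀ p → D p ≡ true → D ∅ ≡ true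
∅-∈-downset {zero} _ [] Dp = Dp
∅-∈-downset {suc n} {D} downset p Dp with Vec.initLast p
... | _ , inside , refl = subst (λ x → D x ≡ true) (sym (∅∷ʳoutside n)) (slice-outside-full downset Dp ∅)
... | p′ , outside , refl = subst (λ x → D x ≡ true) (sym (∅∷ʳoutside n))
  (∅-∈-downset (slice-downset downset outside) p′ Dp)

length-allSubsets : ∀ n → length (allSubsets n) ≡ 2 ^ n
length-allSubsets zero = refl
length-allSubsets (suc n) = begin-equality
  length (map (outside ∷_) S ++ map (inside ∷_) S)
    ≡⟨ List.length-++ (map (outside ∷_) S) ⟩
  length (map (outside ∷_) S) + length (map (inside ∷_) S)
    ≡⟨ cong₂ _+_ (List.length-map _ S) (List.length-map _ S) ⟩
  length S + length S
    ≡⟨ cong₂ _+_ (length-allSubsets n) (trans (length-allSubsets n) (sym (*-identityˡ (2 ^ n)))) ⟩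
  2 ^ suc n ∎
  where
  S = allSubsets n
  open ≤-Reasoning

length-filter-map : ∀ {a b p} {A : Set a} {B : Set b} {P : B → Set p} (P? : Decidable P) (f : A → B) xs →
  length (filter P? (map f xs)) ≡ length (filter (P? ∘ f) xs)
length-filter-map P? f [] = refl
length-filter-map P? f (x ∷ xs) with does (P? (f x))
... | true = cong suc (length-filter-map P? f xs)
... | false = length-filter-map P? f xs

card-∷ : ∀ {n} (D : Family (suc n)) → card D ≡ card (D ∘ (outside ∷_)) + card (D ∘ (inside ∷_))
card-∷ {n} D = begin-equality
  length (filter D? (map (outside ∷_) S ++ map (inside ∷_) S))
    ≡⟨ cong length (List.filter-++ D? (map (outside ∷_) S) _) ⟩
  length (filter D? (map (outside ∷_) S) ++ filter D? (map (inside ∷_) S))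
    ≡⟨ List.length-++ (filter D? (map (outside ∷_) S)) ⟩
  length (filter D? (map (outside ∷_) S)) + length (filter D? (map (inside ∷_) S))
    ≡⟨ cong₂ _+_ (length-filter-map D? (outside ∷_) S) (length-filter-map D? (inside ∷_) S) ⟩
  card (D ∘ (outside ∷_)) + card (D ∘ (inside ∷_)) ∎
  where
  S = allSubsets n
  D? = λ A → D A ≟ true
  open ≤-Reasoning

card-cong : ∀ {n} {D E : Family n} → (∀ p → D p ≡ E p) → card D ≡ card E
card-cong {n} {D} {E} D≗E = cong length (List.filter-≐ (λ p → D p ≟ true) (λ p → E p ≟ true)
  ((λ {p} → trans (sym (D≗E p))) , (λ {p} → trans (D≗E p))) (allSubsets n))

card-∷ʳ : ∀ {n} (D : Family (suc n)) → card D ≡ card (slice D outside) + card (slice D inside)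
card-∷ʳ {zero} D = trans (card-∷ D)
  (cong₂ _+_ (card-cong {D = D ∘ (outside ∷_)} {slice D outside} λ { [] → refl })
    (card-cong {D = D ∘ (inside ∷_)} {slice D inside} λ { [] → refl }))
card-∷ʳ {suc n} D = begin-equality
  card D ≡⟨ card-∷ D ⟩
  card D₀ + card D₁ ≡⟨ cong₂ _+_ (card-∷ʳ D₀) (card-∷ʳ D₁) ⟩
  (card (slice D₀ outside) + card (slice D₀ inside)) + (card (slice D₁ outside) + card (slice D₁ inside))
    ≡⟨ +-interchange (card (slice D₀ outside)) _ _ _ ⟩
  (card (slice D₀ outside) + card (slice D₁ outside)) + (card (slice D₀ inside) + card (slice D₁ inside))
    ≡⟨ cong₂ _+_ (sym (card-∷ (slice D outside))) (sym (card-∷ (slice D inside))) ⟩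
  card (slice D outside) + card (slice D inside) ∎
  where
  D₀ = D ∘ (outside ∷_)
  D₁ = D ∘ (inside ∷_)
  open ≤-Reasoning

card≤2^n : ∀ {n} (D : Family n) → card D ≤ 2 ^ n
card≤2^n {n} D = ≤-trans (List.length-filter (λ A → D A ≟ true) (allSubsets n)) (≤-reflexive (length-allSubsets n))

card-full : ∀ {n} {D : Family n} → (∀ p → D p ≡ true) → card D ≡ 2 ^ n
card-full {n} {D} full =
  trans (cong length (List.filter-all (λ A → D A ≟ true) (All.universal full (allSubsets n)))) (length-allSubsets n)

card≡0⊎nonempty : ∀ {n} (D : Family n) → card D ≡ 0 ⊎ Nonempty D
card≡0⊎nonempty {n} D with filter (λ A → D A ≟ true) (allSubsets n) in eq
... | [] = inj₁ refl
... | p ∷ _ = inj₂ (p , proj₂ (∈-filter⁻ (λ A → D A ≟ true) {xs = allSubsets n} p∈filter))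
  where
  p∈filter = subst (p ∈ₗ_) (sym eq) (here refl)

[1+k]*[1+n]C[1+k]≡[1+n]*nCk : ∀ n k → suc k * (suc n C suc k) ≡ suc n * (n C k)
[1+k]*[1+n]C[1+k]≡[1+n]*nCk zero zero = refl
[1+k]*[1+n]C[1+k]≡[1+n]*nCk zero (suc k) = *-zeroʳ (2 + k)
[1+k]*[1+n]C[1+k]≡[1+n]*nCk (suc n) zero = trans (*-identityˡ _) (trans (nC1≡n (2 + n)) (sym (*-identityʳ _)))
[1+k]*[1+n]C[1+k]≡[1+n]*nCk (suc n) (suc k) = begin-equality
  (2 + k) * ((2 + n) C (2 + k))
    ≡⟨ cong ((2 + k) *_) (sym (nCk+nC[k+1]≡[n+1]C[k+1] (suc n) (suc k))) ⟩
  (2 + k) * (x + y)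
    ≡⟨ distribute k x y ⟩
  ((1 + k) * x + (2 + k) * y) + x
    ≡⟨ cong (_+ x) (cong₂ _+_ ([1+k]*[1+n]C[1+k]≡[1+n]*nCk n k) ([1+k]*[1+n]C[1+k]≡[1+n]*nCk n (suc k))) ⟩
  ((1 + n) * (n C k) + (1 + n) * (n C suc k)) + x
    ≡⟨ cong (_+ x) (sym (*-distribˡ-+ (1 + n) (n C k) _)) ⟩
  (1 + n) * (n C k + n C suc k) + x
    ≡⟨ cong (λ z → (1 + n) * z + x) (nCk+nC[k+1]≡[n+1]C[k+1] n k) ⟩
  (1 + n) * x + x
    ≡⟨ +-comm ((1 + n) * x) x ⟩
  (2 + n) * x ∎
  where
  x = suc n C suc k
  y = suc n C (2 + k)
  distribute : ∀ k x y → (2 + k) * (x + y) ≡ ((1 + k) * x + (2 + k) * y) + x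
  distribute = solve-∀
  open ≤-Reasoning

nCk≤nC[1+k] : ∀ {n k} → suc k + suc k ≤ suc n → n C k ≤ n C suc k
nCk≤nC[1+k] {n} {k} 2k+2≤n+1 = *-cancelˡ-≤ (suc k) (+-cancelˡ-≤ (suc k * (n C k)) _ _ (begin
  suc k * (n C k) + suc k * (n C k)     ≡⟨ sym (*-distribʳ-+ (n C k) (suc k) (suc k)) ⟩
  (suc k + suc k) * (n C k)              ≤⟨ *-monoˡ-≤ (n C k) 2k+2≤n+1 ⟩
  suc n * (n C k)                        ≡⟨ sym ([1+k]*[1+n]C[1+k]≡[1+n]*nCk n k) ⟩
  suc k * (suc n C suc k)                ≡⟨ cong (suc k *_) (sym (nCk+nC[k+1]≡[n+1]C[k+1] n k)) ⟩
  suc k * (n C k + n C suc k)            ≡⟨ *-distribˡ-+ (suc k) (n C k) _ ⟩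
  suc k * (n C k) + suc k * (n C suc k) ∎))
  where open ≤-Reasoning

nC[1+k]≡nCk : ∀ {n k} → suc n ≡ suc k + suc k → n C suc k ≡ n C k
nC[1+k]≡nCk {k = k} n+1≡2k+2 with refl ← suc-injective n+1≡2k+2 =
  trans (nCk≡nC[n∸k] (m≤n+m (suc k) k)) (cong ((k + suc k) C_) (m+n∸n≡m k (suc k)))

[1+n]C[1+r]≤nCr′+nCr′ : ∀ {n r} → suc r + suc r ≤ suc n →
  ∃ λ r′ → r′ ≤ suc r × r′ + r′ ≤ n × suc n C suc r ≤ n C r′ + n C r′
[1+n]C[1+r]≤nCr′+nCr′ {n} {r} 2r+2≤n+1 with suc r + suc r ≤? n
... | yes 2r+2≤n = suc r , ≤-refl , 2r+2≤n , (begin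
  suc n C suc r         ≡⟨ sym (nCk+nC[k+1]≡[n+1]C[k+1] n r) ⟩
  n C r + n C suc r     ≤⟨ +-monoˡ-≤ (n C suc r) (nCk≤nC[1+k] (m≤n⇒m≤1+n 2r+2≤n)) ⟩
  n C suc r + n C suc r ∎)
  where open ≤-Reasoning
... | no 2r+2≰n = r , n≤1+n r , 2r≤n , ≤-reflexive (begin-equality
  suc n C suc r         ≡⟨ sym (nCk+nC[k+1]≡[n+1]C[k+1] n r) ⟩
  n C r + n C suc r     ≡⟨ cong (n C r +_) (nC[1+k]≡nCk n+1≡2r+2) ⟩
  n C r + n C r         ∎)
  where
  open ≤-Reasoning
  n+1≡2r+2 : suc n ≡ suc r + suc r
  n+1≡2r+2 = ≤-antisym (≰⇒> 2r+2≰n) 2r+2≤n+1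
  2r≤n : r + r ≤ n
  2r≤n = ≤-trans (+-monoʳ-≤ r (n≤1+n r)) (≤-reflexive (suc-injective (sym n+1≡2r+2)))

m*n+m*n≡m*[2*n] : ∀ m n → m * n + m * n ≡ m * (2 * n)
m*n+m*n≡m*[2*n] = solve-∀

a*P+b*m≤b*P+a*m : ∀ {a b m P} → a ≤ b → m ≤ P → a * P + b * m ≤ b * P + a * m
a*P+b*m≤b*P+a*m {a} {m = m} a≤b m≤P
  with d , refl ← m≤n⇒∃[o]m+o≡n a≤b | e , refl ← m≤n⇒∃[o]m+o≡n m≤P = begin
  a * (m + e) + (a + d) * m          ≤⟨ m≤m+n _ (d * e) ⟩
  a * (m + e) + (a + d) * m + d * e  ≡⟨ expand a d m e ⟩
  (a + d) * (m + e) + a * m          ∎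
  where
  open ≤-Reasoning
  expand : ∀ a d m e → a * (m + e) + (a + d) * m + d * e ≡ (a + d) * (m + e) + a * m
  expand = solve-∀

[a+b]*[P+m]≤[b+l]*[2*P] : ∀ {a b m l P} → a ≤ b → m ≤ P → a * m ≤ l * P → (a + b) * (P + m) ≤ (b + l) * (2 * P)
[a+b]*[P+m]≤[b+l]*[2*P] {a} {b} {m} {l} {P} a≤b m≤P am≤lP = begin
  (a + b) * (P + m)                        ≡⟨ expand a b P m ⟩
  (a * P + b * m) + (b * P + a * m)        ≤⟨ +-monoˡ-≤ (b * P + a * m) (a*P+b*m≤b*P+a*m a≤b m≤P) ⟩
  (b * P + a * m) + (b * P + a * m)        ≤⟨ +-mono-≤ bP+am≤bP+lP bP+am≤bP+lP ⟩
  (b * P + l * P) + (b * P + l * P)        ≡⟨ collect b l P ⟩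
  (b + l) * (2 * P)                        ∎
  where
  open ≤-Reasoning
  bP+am≤bP+lP = +-monoʳ-≤ (b * P) am≤lP
  expand : ∀ a b P m → (a + b) * (P + m) ≡ (a * P + b * m) + (b * P + a * m)
  expand = solve-∀
  collect : ∀ b l P → (b * P + l * P) + (b * P + l * P) ≡ (b + l) * (2 * P)
  collect = solve-∀

level : ∀ n → ℕ → List (Subset n)
level zero zero = [] ∷ []
level zero (suc r) = []
level (suc n) zero = map (outside ∷_) (level n zero)
level (suc n) (suc r) = map (outside ∷_) (level n (suc r)) ++ map (inside ∷_) (level n r)

length-level : ∀ n r → length (level n r) ≡ n C r
length-level zero zero = refl
length-level zero (suc r) = refl
length-level (suc n) zero = trans (List.length-map (outside ∷_) (level n zero)) (length-level n zero)
length-level (suc n) (suc r) = begin-equality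
  length (map (outside ∷_) (level n (suc r)) ++ map (inside ∷_) (level n r))
    ≡⟨ List.length-++ (map (outside ∷_) (level n (suc r))) ⟩
  length (map (outside ∷_) (level n (suc r))) + length (map (inside ∷_) (level n r))
    ≡⟨ cong₂ _+_ (List.length-map _ (level n (suc r))) (List.length-map _ (level n r)) ⟩
  length (level n (suc r)) + length (level n r)
    ≡⟨ cong₂ _+_ (length-level n (suc r)) (length-level n r) ⟩
  n C suc r + n C r
    ≡⟨ +-comm (n C suc r) (n C r) ⟩
  n C r + n C suc r
    ≡⟨ nCk+nC[k+1]≡[n+1]C[k+1] n r ⟩
  suc n C suc r ∎
  where open ≤-Reasoning

level-size : ∀ n r → All (λ p → ∣ p ∣ ≡ r) (level n r)
level-size zero zero = refl ∷ []
level-size zero (suc r) = []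
level-size (suc n) zero = All.map⁺ (level-size n zero)
level-size (suc n) (suc r) =
  All.++⁺ (All.map⁺ (level-size n (suc r))) (All.map⁺ (All.map (cong suc) (level-size n r)))

level-antichain : ∀ n r → AllPairs _∥_ (level n r)
level-antichain zero zero = [] ∷ []
level-antichain zero (suc r) = []
level-antichain (suc n) zero = map-∷-antichain outside (level-antichain n zero)
level-antichain (suc n) (suc r) = AllPairs.++⁺
  (map-∷-antichain outside (level-antichain n (suc r))) (map-∷-antichain inside (level-antichain n r))
  (All.map⁺ (All.map (λ ∣p∣≡r+1 → All.map⁺ (All.map (λ ∣q∣≡r →
    outside∷-∥-inside∷ (level-gap ∣p∣≡r+1 ∣q∣≡r)) (level-size n r))) (level-size n (suc r))))
  where
  level-gap : ∀ {i j} → i ≡ suc r → j ≡ r → j < i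
  level-gap refl refl = ≤-refl

-- Symmetric chain decomposition

IsChain : ∀ {n} → List (Subset n) → Set
IsChain = AllPairs _⊆_

grow : ∀ {n} → List (Subset n) → List (Subset (suc n))
grow [] = []
grow (x ∷ []) = (outside ∷ x) ∷ (inside ∷ x) ∷ []
grow (x ∷ xs@(_ ∷ _)) = (outside ∷ x) ∷ grow xs

shrink : ∀ {n} → List (Subset n) → List (Subset (suc n))
shrink [] = []
shrink (x ∷ []) = []
shrink (x ∷ xs@(_ ∷ _)) = (inside ∷ x) ∷ shrink xs

extend : ∀ {n} → List (Subset n) → List (List (Subset (suc n)))
extend [] = []
extend c@(_ ∷ []) = grow c ∷ []
extend c@(_ ∷ _ ∷ _) = grow c ∷ shrink c ∷ []

symmetricChains : ∀ n → List (List (Subset n))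
symmetricChains zero = ([] ∷ []) ∷ []
symmetricChains (suc n) = concatMap extend (symmetricChains n)

module _ {n} {P : Subset n → Set} {Q : Subset (suc n) → Set} where

  All-grow : (∀ {x} b → P x → Q (b ∷ x)) → ∀ {xs} → All P xs → All Q (grow xs)
  All-grow f [] = []
  All-grow f (px ∷ []) = f outside px ∷ f inside px ∷ []
  All-grow f (px ∷ pxs@(_ ∷ _)) = f outside px ∷ All-grow f pxs

  All-shrink : (∀ {x} → P x → Q (inside ∷ x)) → ∀ {xs} → All P xs → All Q (shrink xs)
  All-shrink f [] = []
  All-shrink f (px ∷ []) = []
  All-shrink f (px ∷ pxs@(_ ∷ _)) = f px ∷ All-shrink f pxs

grow-chain : ∀ {n} {xs : List (Subset n)} → IsChain xs → IsChain (grow xs)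
grow-chain [] = []
grow-chain ([] ∷ []) = (out⊆ ⊆-refl ∷ []) ∷ [] ∷ []
grow-chain (x⊆ ∷ c@(_ ∷ _)) = All-grow (λ _ → out⊆) x⊆ ∷ grow-chain c

shrink-chain : ∀ {n} {xs : List (Subset n)} → IsChain xs → IsChain (shrink xs)
shrink-chain [] = []
shrink-chain (_ ∷ []) = []
shrink-chain (x⊆ ∷ c@(_ ∷ _)) = All-shrink s⊆s x⊆ ∷ shrink-chain c

extend-chains : ∀ {n} {xs : List (Subset n)} → IsChain xs → All IsChain (extend xs)
extend-chains [] = []
extend-chains c@(_ ∷ []) = grow-chain c ∷ []
extend-chains c@(_ ∷ _ ∷ _) = grow-chain c ∷ shrink-chain c ∷ []

symmetricChains-chains : ∀ n → All IsChain (symmetricChains n)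
symmetricChains-chains zero = ([] ∷ []) ∷ []
symmetricChains-chains (suc n) = All.concat⁺ (All.map⁺ (All.map extend-chains (symmetricChains-chains n)))

module _ {n} {x : Subset n} where

  outside∷-∈-grow : ∀ {xs} → x ∈ₗ xs → outside ∷ x ∈ₗ grow xs
  outside∷-∈-grow {_ ∷ []} (here refl) = here refl
  outside∷-∈-grow {_ ∷ _ ∷ _} (here refl) = here refl
  outside∷-∈-grow {_ ∷ _ ∷ _} (there x∈xs) = there (outside∷-∈-grow x∈xs)

  inside∷-∈-grow⊎shrink : ∀ {xs} → x ∈ₗ xs → inside ∷ x ∈ₗ grow xs ⊎ inside ∷ x ∈ₗ shrink xs
  inside∷-∈-grow⊎shrink {_ ∷ []} (here refl) = inj₁ (there (here refl))
  inside∷-∈-grow⊎shrink {_ ∷ _ ∷ _} (here refl) = inj₂ (here refl)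
  inside∷-∈-grow⊎shrink {_ ∷ _ ∷ _} (there x∈xs) with inside∷-∈-grow⊎shrink x∈xs
  ... | inj₁ ∈grow = inj₁ (there ∈grow)
  ... | inj₂ ∈shrink = inj₂ (there ∈shrink)

module _ {n} {y : Subset (suc n)} where

  ∈-grow⇒∈-extend : ∀ {xs} → y ∈ₗ grow xs → Any (y ∈ₗ_) (extend xs)
  ∈-grow⇒∈-extend {_ ∷ []} y∈ = here y∈
  ∈-grow⇒∈-extend {_ ∷ _ ∷ _} y∈ = here y∈

  ∈-shrink⇒∈-extend : ∀ {xs} → y ∈ₗ shrink xs → Any (y ∈ₗ_) (extend xs)
  ∈-shrink⇒∈-extend {_ ∷ _ ∷ _} y∈ = there (here y∈)

∷-∈-extend : ∀ {n} {x : Subset n} {xs} b → x ∈ₗ xs → Any (b ∷ x ∈ₗ_) (extend xs)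
∷-∈-extend outside x∈xs = ∈-grow⇒∈-extend (outside∷-∈-grow x∈xs)
∷-∈-extend inside x∈xs = [ ∈-grow⇒∈-extend , ∈-shrink⇒∈-extend ]′ (inside∷-∈-grow⊎shrink x∈xs)

symmetricChains-cover : ∀ {n} (p : Subset n) → Any (p ∈ₗ_) (symmetricChains n)
symmetricChains-cover [] = here (here refl)
symmetricChains-cover (b ∷ p) = Any.concat⁺ (Any.map⁺ (Any.map (∷-∈-extend b) (symmetricChains-cover p)))

𝟙[_≤_] : ℕ → ℕ → ℕ
𝟙[ zero ≤ m ] = 1
𝟙[ suc k ≤ zero ] = 0
𝟙[ suc k ≤ suc m ] = 𝟙[ k ≤ m ]

module _ {a} {A : Set a} where

  #chains≥ : ℕ → List (List A) → ℕ
  #chains≥ k [] = 0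
  #chains≥ k (c ∷ cs) = 𝟙[ k ≤ length c ] + #chains≥ k cs

  #chains≥-++ : ∀ k cs ds → #chains≥ k (cs ++ ds) ≡ #chains≥ k cs + #chains≥ k ds
  #chains≥-++ k [] ds = refl
  #chains≥-++ k (c ∷ cs) ds =
    trans (cong (𝟙[ k ≤ length c ] +_) (#chains≥-++ k cs ds)) (sym (+-assoc 𝟙[ k ≤ length c ] _ _))

  #chains≥0≡#chains≥1 : ∀ {cs} → All (λ c → 0 < length c) cs → #chains≥ 0 cs ≡ #chains≥ 1 cs
  #chains≥0≡#chains≥1 [] = refl
  #chains≥0≡#chains≥1 {(_ ∷ _) ∷ _} (_ ∷ nonempty) = cong suc (#chains≥0≡#chains≥1 nonempty)

  #chains≥0≡length : ∀ cs → #chains≥ 0 cs ≡ length cs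
  #chains≥0≡length [] = refl
  #chains≥0≡length (_ ∷ cs) = cong suc (#chains≥0≡length cs)

length-grow : ∀ {n} (x : Subset n) xs → length (grow (x ∷ xs)) ≡ 2 + length xs
length-grow x [] = refl
length-grow x (y ∷ xs) = cong suc (length-grow y xs)

length-shrink : ∀ {n} (x : Subset n) xs → length (shrink (x ∷ xs)) ≡ length xs
length-shrink x [] = refl
length-shrink x (y ∷ xs) = cong suc (length-shrink y xs)

extend-nonempty : ∀ {n} (xs : List (Subset n)) → All (λ c → 0 < length c) (extend xs)
extend-nonempty [] = []
extend-nonempty (_ ∷ []) = s≤s z≤n ∷ []
extend-nonempty (_ ∷ _ ∷ _) = s≤s z≤n ∷ s≤s z≤n ∷ []

symmetricChains-nonempty : ∀ n → All (λ c → 0 < length c) (symmetricChains n)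
symmetricChains-nonempty zero = s≤s z≤n ∷ []
symmetricChains-nonempty (suc n) = All.concat⁺ (All.map⁺ (All.universal extend-nonempty (symmetricChains n)))

#chains≥-extend : ∀ {n} k (xs : List (Subset n)) → 0 < length xs →
  #chains≥ (suc k) (extend xs) ≡ 𝟙[ k ≤ length xs ] + 𝟙[ 2 + k ≤ length xs ]
#chains≥-extend k (x ∷ []) _ = refl
#chains≥-extend k (x ∷ y ∷ xs) _ = cong₂ (λ g s → 𝟙[ k ≤ g ] + s) (length-grow y xs)
  (trans (+-identityʳ _) (cong (λ m → 𝟙[ k ≤ m ]) (length-shrink y xs)))

#chains≥-concatMap-extend : ∀ {n} k {cs : List (List (Subset n))} → All (λ c → 0 < length c) cs →
  #chains≥ (suc k) (concatMap extend cs) ≡ #chains≥ k cs + #chains≥ (2 + k) cs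
#chains≥-concatMap-extend k [] = refl
#chains≥-concatMap-extend k {c ∷ cs} (c≢[] ∷ nonempty) = begin-equality
  #chains≥ (suc k) (extend c ++ concatMap extend cs)
    ≡⟨ #chains≥-++ (suc k) (extend c) _ ⟩
  #chains≥ (suc k) (extend c) + #chains≥ (suc k) (concatMap extend cs)
    ≡⟨ cong₂ _+_ (#chains≥-extend k c c≢[]) (#chains≥-concatMap-extend k nonempty) ⟩
  (𝟙[ k ≤ length c ] + 𝟙[ 2 + k ≤ length c ]) + (#chains≥ k cs + #chains≥ (2 + k) cs)
    ≡⟨ +-interchange 𝟙[ k ≤ length c ] _ _ _ ⟩
  #chains≥ k (c ∷ cs) + #chains≥ (2 + k) (c ∷ cs) ∎
  where open ≤-Reasoning

#chains≥-symmetricChains-suc : ∀ n k →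
  #chains≥ (suc k) (symmetricChains (suc n)) ≡ #chains≥ k (symmetricChains n) + #chains≥ (2 + k) (symmetricChains n)
#chains≥-symmetricChains-suc n k = #chains≥-concatMap-extend k (symmetricChains-nonempty n)

#chains≥-symmetricChains-vanish : ∀ n k → suc n < k → #chains≥ k (symmetricChains n) ≡ 0
#chains≥-symmetricChains-vanish zero (suc zero) (s≤s ())
#chains≥-symmetricChains-vanish zero (suc (suc k)) _ = refl
#chains≥-symmetricChains-vanish (suc n) (suc k) n+2<k+1 = trans (#chains≥-symmetricChains-suc n k)
  (cong₂ _+_ (#chains≥-symmetricChains-vanish n k (s≤s⁻¹ n+2<k+1))
             (#chains≥-symmetricChains-vanish n (2 + k) (m<n⇒m<1+n (m<n⇒m<1+n (s≤s⁻¹ n+2<k+1)))))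

-- L is n + 1 − 2b, the length of a symmetric chain starting on level b, or one less.
Balanced : ℕ → ℕ → ℕ → Set
Balanced n L b = L + (b + b) ≡ n ⊎ L + (b + b) ≡ suc n

Balanced-shift : ∀ {n L b} → Balanced n L (suc b) → Balanced n (2 + L) b
Balanced-shift {L = L} {b} = Sum.map (trans (sym (regroup L b))) (trans (sym (regroup L b)))
  where
  regroup : ∀ L b → L + (suc b + suc b) ≡ 2 + L + (b + b)
  regroup = solve-∀

#chains≥-symmetricChains-step : ∀ n L b → Balanced n L b →
  (∀ L b → Balanced n L b → #chains≥ L (symmetricChains n) ≡ n C b) →
  #chains≥ (suc L) (symmetricChains (suc n)) ≡ suc n C b
#chains≥-symmetricChains-step n L zero balanced ih = begin-equality
  #chains≥ (suc L) (symmetricChains (suc n))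
    ≡⟨ #chains≥-symmetricChains-suc n L ⟩
  #chains≥ L (symmetricChains n) + #chains≥ (2 + L) (symmetricChains n)
    ≡⟨ cong₂ _+_ (ih L 0 balanced) (#chains≥-symmetricChains-vanish n (2 + L) (s≤s (s≤s n≤L))) ⟩
  1 + 0 ∎
  where
  open ≤-Reasoning
  n≤L : n ≤ L
  n≤L = subst (n ≤_) (+-identityʳ L)
    ([ ≤-reflexive ∘ sym , (λ e → ≤-trans (n≤1+n n) (≤-reflexive (sym e))) ]′ balanced)
#chains≥-symmetricChains-step n L (suc b) balanced ih = begin-equality
  #chains≥ (suc L) (symmetricChains (suc n))
    ≡⟨ #chains≥-symmetricChains-suc n L ⟩
  #chains≥ L (symmetricChains n) + #chains≥ (2 + L) (symmetricChains n)
    ≡⟨ cong₂ _+_ (ih L (suc b) balanced) (ih (2 + L) b (Balanced-shift balanced)) ⟩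
  n C suc b + n C b
    ≡⟨ +-comm (n C suc b) (n C b) ⟩
  n C b + n C suc b
    ≡⟨ nCk+nC[k+1]≡[n+1]C[k+1] n b ⟩
  suc n C suc b ∎
  where open ≤-Reasoning

#chains≥-symmetricChains : ∀ n L b → Balanced n L b → #chains≥ L (symmetricChains n) ≡ n C b
#chains≥-symmetricChains zero zero zero _ = refl
#chains≥-symmetricChains zero (suc zero) zero _ = refl
#chains≥-symmetricChains zero (suc (suc L)) zero (inj₁ ())
#chains≥-symmetricChains zero (suc (suc L)) zero (inj₂ ())
#chains≥-symmetricChains zero L (suc b) balanced = ⊥-elim ([ (λ ()) , (λ ()) ]′ (Balanced-shift balanced))
#chains≥-symmetricChains (suc n) (suc L) b balanced =
  #chains≥-symmetricChains-step n L b (Sum.map suc-injective suc-injective balanced) (#chains≥-symmetricChains n)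
#chains≥-symmetricChains (suc n) zero zero (inj₁ ())
#chains≥-symmetricChains (suc n) zero zero (inj₂ ())
#chains≥-symmetricChains (suc n) zero b (inj₁ 2b≡n+1) =
  trans (#chains≥0≡#chains≥1 (symmetricChains-nonempty (suc n)))
        (#chains≥-symmetricChains-step n 0 b (inj₂ 2b≡n+1) (#chains≥-symmetricChains n))
#chains≥-symmetricChains (suc n) zero (suc b) (inj₂ 2b+2≡n+2) = begin-equality
  #chains≥ 0 (symmetricChains (suc n))
    ≡⟨ #chains≥0≡#chains≥1 (symmetricChains-nonempty (suc n)) ⟩
  #chains≥ 1 (symmetricChains (suc n))
    ≡⟨ #chains≥-symmetricChains-step n 0 b (inj₁ 2b≡n) (#chains≥-symmetricChains n) ⟩
  suc n C b
    ≡⟨ sym (nC[1+k]≡nCk (sym 2b+2≡n+2)) ⟩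
  suc n C suc b ∎
  where
  open ≤-Reasoning
  2b≡n : b + b ≡ n
  2b≡n = suc-injective (trans (sym (+-suc b b)) (suc-injective 2b+2≡n+2))

⌊n/2⌋+⌊n/2⌋-parity : ∀ n → suc (⌊ n /2⌋ + ⌊ n /2⌋) ≡ n ⊎ ⌊ n /2⌋ + ⌊ n /2⌋ ≡ n
⌊n/2⌋+⌊n/2⌋-parity zero = inj₂ refl
⌊n/2⌋+⌊n/2⌋-parity (suc zero) = inj₁ refl
⌊n/2⌋+⌊n/2⌋-parity (suc (suc n)) =
  Sum.map (λ e → cong (2 +_) (trans (+-suc h h) e)) (λ e → cong suc (trans (+-suc h h) (cong suc e)))
          (⌊n/2⌋+⌊n/2⌋-parity n)
  where h = ⌊ n /2⌋

⌊n/2⌋+⌊n/2⌋≤n : ∀ n → ⌊ n /2⌋ + ⌊ n /2⌋ ≤ n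
⌊n/2⌋+⌊n/2⌋≤n n = [ (λ e → ≤-trans (n≤1+n _) (≤-reflexive e)) , ≤-reflexive ]′ (⌊n/2⌋+⌊n/2⌋-parity n)

length-symmetricChains : ∀ n → length (symmetricChains n) ≡ n C ⌊ n /2⌋
length-symmetricChains n = begin-equality
  length (symmetricChains n)
    ≡⟨ sym (#chains≥0≡length (symmetricChains n)) ⟩
  #chains≥ 0 (symmetricChains n)
    ≡⟨ #chains≥0≡#chains≥1 (symmetricChains-nonempty n) ⟩
  #chains≥ 1 (symmetricChains n)
    ≡⟨ #chains≥-symmetricChains n 1 ⌊ n /2⌋ (Sum.map id (cong suc) (⌊n/2⌋+⌊n/2⌋-parity n)) ⟩
  n C ⌊ n /2⌋ ∎
  where open ≤-Reasoning

antichain-length≤nC⌊n/2⌋ : ∀ {n} {ps : List (Subset n)} → AllPairs _∥_ ps → length ps ≤ n C ⌊ n /2⌋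
antichain-length≤nC⌊n/2⌋ {n} antichain = ≤-trans
  (antichain-length≤#chains (λ {_} {_} i∈p → i∈p) (symmetricChains-chains n) symmetricChains-cover antichain)
  (≤-reflexive (length-symmetricChains n))

-- Dense antichains in binary downsets

record DenseAntichain {n} (D : Family n) (r : ℕ) : Set where
  field
    members   : List (Subset n)
    antichain : IsAntichainIn D members
    small     : All (λ p → ∣ p ∣ ≤ r) members
    dense     : (n C r) * card D ≤ length members * 2 ^ n

denseAntichain-zero : ∀ {n} {D : Family n} → IsBinaryInitialSegment D → DenseAntichain D 0
denseAntichain-zero {n} {D} downset with card≡0⊎nonempty D
... | inj₁ card≡0 = record
  { members   = []
  ; antichain = [] , []
  ; small     = []
  ; dense     = ≤-reflexive (trans (cong ((n C 0) *_) card≡0) (*-zeroʳ (n C 0)))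
  }
... | inj₂ (p , Dp) = record
  { members   = ∅ ∷ []
  ; antichain = ∅-∈-downset downset p Dp ∷ [] , [] ∷ []
  ; small     = ≤-reflexive (∣⊥∣≡0 n) ∷ []
  ; dense     = *-monoʳ-≤ 1 (card≤2^n D)
  }

denseAntichain-topEmpty : ∀ {n r r′} {D : Family (suc n)} → card (slice D inside) ≡ 0 → r′ ≤ suc r →
  suc n C suc r ≤ n C r′ + n C r′ → DenseAntichain (slice D outside) r′ → DenseAntichain D (suc r)
denseAntichain-topEmpty {n} {r} {r′} {D} top-empty r′≤r+1 binomial A = record
  { members   = map (_∷ʳ outside) members
  ; antichain = All.map⁺ (proj₁ antichain) , map-∷ʳ-antichain outside (proj₂ antichain)
  ; small     = All.map⁺ (All.map (λ {p} ∣p∣≤r′ →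
      subst (_≤ suc r) (sym (∣p∷ʳoutside∣≡∣p∣ p)) (≤-trans ∣p∣≤r′ r′≤r+1)) small)
  ; dense     = begin
      (suc n C suc r) * card D                        ≡⟨ cong ((suc n C suc r) *_) card-D≡card-D₀ ⟩
      (suc n C suc r) * card D₀                       ≤⟨ *-monoˡ-≤ (card D₀) binomial ⟩
      (n C r′ + n C r′) * card D₀                     ≡⟨ *-distribʳ-+ (card D₀) (n C r′) _ ⟩
      (n C r′) * card D₀ + (n C r′) * card D₀         ≤⟨ +-mono-≤ dense dense ⟩
      length members * 2 ^ n + length members * 2 ^ n ≡⟨ m*n+m*n≡m*[2*n] (length members) (2 ^ n) ⟩
      length members * 2 ^ suc n                      ≡⟨ cong (_* 2 ^ suc n) (sym (List.length-map _ members)) ⟩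
      length (map (_∷ʳ outside) members) * 2 ^ suc n  ∎
  }
  where
  open DenseAntichain A
  open ≤-Reasoning
  D₀ = slice D outside
  card-D≡card-D₀ : card D ≡ card D₀
  card-D≡card-D₀ = trans (card-∷ʳ D) (trans (cong (card D₀ +_) top-empty) (+-identityʳ (card D₀)))

denseAntichain-topNonempty : ∀ {n r} {D : Family (suc n)} → suc r + suc r ≤ suc n →
  (∀ p → slice D outside p ≡ true) → DenseAntichain (slice D inside) r → DenseAntichain D (suc r)
denseAntichain-topNonempty {n} {r} {D} 2r+2≤n+1 bottom-full A = record
  { members   = lower ++ upper
  ; antichain = All.++⁺ lower⊆D upper⊆D , AllPairs.++⁺ lower-antichain upper-antichain lower∥upper
  ; small     = All.++⁺ lower-small upper-small
  ; dense     = begin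
      (suc n C suc r) * card D
        ≡⟨ cong₂ _*_ (sym (nCk+nC[k+1]≡[n+1]C[k+1] n r)) card-D ⟩
      (n C r + n C suc r) * (2 ^ n + card D₁)
        ≤⟨ [a+b]*[P+m]≤[b+l]*[2*P] (nCk≤nC[1+k] 2r+2≤n+1) (card≤2^n D₁) dense ⟩
      (n C suc r + length members) * 2 ^ suc n
        ≡⟨ cong (_* 2 ^ suc n) (sym length-members) ⟩
      length (lower ++ upper) * 2 ^ suc n ∎
  }
  where
  open DenseAntichain A
  open ≤-Reasoning
  D₁ = slice D inside
  lower = map (_∷ʳ outside) (level n (suc r))
  upper = map (_∷ʳ inside) members

  lower⊆D : All (λ p → D p ≡ true) lower
  lower⊆D = All.map⁺ (All.universal bottom-full (level n (suc r)))
  upper⊆D : All (λ p → D p ≡ true) upper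
  upper⊆D = All.map⁺ (proj₁ antichain)

  lower-antichain : AllPairs _∥_ lower
  lower-antichain = map-∷ʳ-antichain outside (level-antichain n (suc r))
  upper-antichain : AllPairs _∥_ upper
  upper-antichain = map-∷ʳ-antichain inside (proj₂ antichain)
  lower∥upper : All (λ p → All (p ∥_) upper) lower
  lower∥upper = All.map⁺ (All.map (λ ∣p∣≡r+1 → All.map⁺ (All.map (λ ∣q∣≤r →
    ∷ʳoutside-∥-∷ʳinside (subst (_ <_) (sym ∣p∣≡r+1) (s≤s ∣q∣≤r))) small)) (level-size n (suc r)))

  lower-small : All (λ p → ∣ p ∣ ≤ suc r) lower
  lower-small = All.map⁺ (All.map (λ {p} ∣p∣≡r+1 →
    ≤-reflexive (trans (∣p∷ʳoutside∣≡∣p∣ p) ∣p∣≡r+1)) (level-size n (suc r)))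
  upper-small : All (λ p → ∣ p ∣ ≤ suc r) upper
  upper-small = All.map⁺ (All.map (λ {q} ∣q∣≤r →
    subst (_≤ suc r) (sym (∣p∷ʳinside∣≡1+∣p∣ q)) (s≤s ∣q∣≤r)) small)

  card-D : card D ≡ 2 ^ n + card D₁
  card-D = trans (card-∷ʳ D) (cong (_+ card D₁) (card-full bottom-full))
  length-members : length (lower ++ upper) ≡ n C suc r + length members
  length-members = trans (List.length-++ lower) (cong₂ _+_
    (trans (List.length-map _ (level n (suc r))) (length-level n (suc r))) (List.length-map _ members))

downset⇒denseAntichain : ∀ {n} r → r + r ≤ n → {D : Family n} → IsBinaryInitialSegment D → DenseAntichain D r
downset⇒denseAntichain zero _ downset = denseAntichain-zero downset
downset⇒denseAntichain {zero} (suc r) ()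
downset⇒denseAntichain {suc n} (suc r) 2r+2≤n+1 {D} downset with card≡0⊎nonempty (slice D inside)
... | inj₁ top-empty =
  let r′ , r′≤r+1 , 2r′≤n , binomial = [1+n]C[1+r]≤nCr′+nCr′ 2r+2≤n+1
  in denseAntichain-topEmpty top-empty r′≤r+1 binomial
       (downset⇒denseAntichain r′ 2r′≤n (slice-downset downset outside))
... | inj₂ (_ , Dq) = denseAntichain-topNonempty 2r+2≤n+1 (slice-outside-full downset Dq)
  (downset⇒denseAntichain r 2r≤n (slice-downset downset inside))
  where
  2r≤n : r + r ≤ n
  2r≤n = ≤-trans (+-monoʳ-≤ r (n≤1+n r)) (s≤s⁻¹ 2r+2≤n+1)

theorem7 : (n : ℕ) →
    (∀ (w : ℕ) → IsWidth (full {n}) w → w ≡ n C ⌊ n /2⌋) ×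
    (∀ (D : Family n) → IsBinaryInitialSegment D → Nonempty D →
      ∀ (w : ℕ) → IsWidth D w →
        (n C ⌊ n /2⌋) * card D ≤ w * 2 ^ n)
theorem7 n = width-full , downset-density
  where
  h = ⌊ n /2⌋
  width-full : ∀ w → IsWidth (full {n}) w → w ≡ n C h
  width-full w ((ps , (_ , antichain) , length≡w) , maximal) = ≤-antisym
    (subst (_≤ n C h) length≡w (antichain-length≤nC⌊n/2⌋ antichain))
    (subst (_≤ w) (length-level n h) (maximal (level n h) (All.universal (λ _ → refl) _ , level-antichain n h)))
  downset-density : ∀ D → IsBinaryInitialSegment D → Nonempty D → ∀ w → IsWidth D w → (n C h) * card D ≤ w * 2 ^ n
  downset-density D downset _ w (_ , maximal) = ≤-trans dense (*-monoˡ-≤ (2 ^ n) (maximal members antichain))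
    where open DenseAntichain (downset⇒denseAntichain h (⌊n/2⌋+⌊n/2⌋≤n n) downset)
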